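{- For any $u \in S_n$, \[ t^{\mathrm{des}(u)}q^{\mathrm{maj}(u)}\prod_{i=1}^n(1+tq^i) = \sum_{w \in B(u)} t^{\mathrm{ndes}(w)}q^{\mathrm{nmaj}(w)}, \] where $B(u)=\{w\in B_n : \mathrm{st}(w)=u\}$.
   Context: Let $[n]=\{1,\dots,n\}$ and let $S_n$ be the set of permutations of $[n]$. The hyperoctahedral group $B_n$ consists of all signed permutations: words $w=w_1\cdots w_n$ on the alphabet $\{\bar 1,1,\dots,\bar n,n\}$ (with $\bar i=-i$) such that $|w|=|w_1|\cdots|w_n|\in S_n$. Letters are totally ordered by $\bar 1<\bar 2<\cdots<\bar n<1<2<\cdots<n$. For a word $w$, $\mathrm{Des}(w)=\{i : w_i>w_{i+1}\}$, $\mathrm{des}(w)=|\mathrm{Des}(w)|$, and $\mathrm{maj}(w)=\sum_{i\in\mathrm{Des}(w)} i$. For $w\in B_n$, the negative descent number is $\mathrm{ndes}(w)=\mathrm{des}(w)+|\{i: w_i<0\}|$ and the negative major index is $\mathrm{nmaj}(w)=\mathrm{maj}(w)+\sum_{w_i<0}|w_i|$. The standardization $\mathrm{st}(w)\in S_n$ of $w\in B_n$ is obtained by replacing the smallest letter of $w$ by $1$, the next smallest by $2$, and so on. -}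

module Defs where

open import Level using (Level)
open import Data.Nat as ℕ using (ℕ; zero; suc; _<ᵇ_; _≡ᵇ_)
open import Data.Integer as ℤ using (ℤ; +_; -[1+_]; ∣_∣)
open import Data.Bool using (Bool; true; false; if_then_else_; _∧_; T)
open import Data.List using (List; []; _∷_; map; foldr; length; filter; upTo; concatMap; _++_)
open import Data.Nat.ListAction using (sum)
open import Algebra.Bundles using (CommutativeSemiring)

oneTo : ℕ → List ℕ
oneTo n = map suc (upTo n)

desSetFrom : {A : Set} → (A → A → Bool) → ℕ → List A → List ℕ
desSetFrom lt i [] = []
desSetFrom lt i (x ∷ []) = []
desSetFrom lt i (x ∷ y ∷ r) =
  if lt y x then i ∷ desSetFrom lt (suc i) (y ∷ r) else desSetFrom lt (suc i) (y ∷ r)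

Des : {A : Set} → (A → A → Bool) → List A → List ℕ
Des lt w = desSetFrom lt 1 w

des : {A : Set} → (A → A → Bool) → List A → ℕ
des lt w = length (Des lt w)

maj : {A : Set} → (A → A → Bool) → List A → ℕ
maj lt w = sum (Des lt w)

ltℕ : ℕ → ℕ → Bool
ltℕ a b = a <ᵇ b

-- order on letters of signed words: 1̄ < 2̄ < ... < n̄ < 1 < 2 < ... < n
-- (letter ī is represented by the integer -i = -[1+ i-1 ])
ltL : ℤ → ℤ → Bool
ltL -[1+ a ] -[1+ b ] = a <ᵇ b
ltL -[1+ _ ] (+ _) = true
ltL (+ _) -[1+ _ ] = false
ltL (+ a) (+ b) = a <ᵇ b

isNeg : ℤ → Bool
isNeg -[1+ _ ] = true
isNeg (+ _) = false

negCount : List ℤ → ℕ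
negCount w = length (filter (λ x → T? (isNeg x)) w)
  where
  open import Data.Bool.Properties using (T?)

negSum : List ℤ → ℕ
negSum w = sum (map ∣_∣ (filter (λ x → T? (isNeg x)) w))
  where
  open import Data.Bool.Properties using (T?)

ndes : List ℤ → ℕ
ndes w = des ltL w ℕ.+ negCount w

nmaj : List ℤ → ℕ
nmaj w = maj ltL w ℕ.+ negSum w

countℕ : ℕ → List ℕ → ℕ
countℕ k [] = 0
countℕ k (x ∷ xs) = if k ≡ᵇ x then suc (countℕ k xs) else countℕ k xs

isPermB : ℕ → List ℕ → Bool
isPermB n u = (length u ≡ᵇ n) ∧ foldr (λ k b → (countℕ k u ≡ᵇ 1) ∧ b) true (oneTo n)

IsPerm : ℕ → List ℕ → Set
IsPerm n u = T (isPermB n u)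

inB : ℕ → List ℤ → Bool
inB n w = isPermB n (map ∣_∣ w)

st : List ℤ → List ℕ
st w = map (λ x → suc (length (filter (λ y → T? (ltL y x)) w))) w
  where
  open import Data.Bool.Properties using (T?)

eqListℕ : List ℕ → List ℕ → Bool
eqListℕ [] [] = true
eqListℕ [] (_ ∷ _) = false
eqListℕ (_ ∷ _) [] = false
eqListℕ (x ∷ xs) (y ∷ ys) = (x ≡ᵇ y) ∧ eqListℕ xs ys

alphabet : ℕ → List ℤ
alphabet n = map (λ i → -[1+ i ]) (upTo n) ++ map (λ i → + suc i) (upTo n)

wordsOf : ℕ → List ℤ → List (List ℤ)
wordsOf zero A = [] ∷ []
wordsOf (suc k) A = concatMap (λ a → map (a ∷_) (wordsOf k A)) A

Bn : ℕ → List (List ℤ)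
Bn n = filter (λ w → T? (inB n w)) (wordsOf n (alphabet n))
  where
  open import Data.Bool.Properties using (T?)

Bu : ℕ → List ℕ → List (List ℤ)
Bu n u = filter (λ w → T? (eqListℕ (st w) u)) (Bn n)
  where
  open import Data.Bool.Properties using (T?)

-- evaluation of polynomial expressions in t, q in an arbitrary commutative semiring
module _ {c ℓ : Level} (R : CommutativeSemiring c ℓ) where
  open CommutativeSemiring R

  pow : Carrier → ℕ → Carrier
  pow x zero = 1#
  pow x (suc k) = x * pow x k

  prodFactor : Carrier → Carrier → ℕ → Carrier
  prodFactor t q zero = 1#
  prodFactor t q (suc n) = prodFactor t q n * (1# + t * pow q (suc n))

  sumR : List Carrier → Carrier
  sumR = foldr _+_ 0#

module Submission where

-- A signed permutation w with st(w) = u is determined by its set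
-- of barred letters, i.e. by a sign vector s ∈ {true,false}ⁿ (entry sᵢ, i < n,
-- is true when the letter of absolute value i+1 is barred).  Listing the n
-- letters of such a w increasingly gives  letters s : the barred letters in
-- increasing order, followed by the unbarred ones; and w is the word  φ u s
-- whose j-th entry is the uⱼ-th element of  letters s.  The proof shows:
--   (1) standardization preserves the descent set, so Des(φ u s) = Des(u);
--   (2) s ↦ φ u s is a bijection from the sign vectors of length n onto B(u),
--       so the list  Bu n u  is a permutation of  map (φ u) (signVectors n);
--   (3) the barred letters of φ u s are those of  letters s , hence
--       ndes(φ u s) = des u + #{i : sᵢ} and nmaj(φ u s) = maj u + Σ_{sᵢ} (i+1);
--   (4) Σ_s t^{#{i : sᵢ}} q^{Σ_{sᵢ}(i+1)} = ∏_{i=1}^{n} (1 + t qⁱ), by induction.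

open import Defs
open import Level using (Level)
open import Algebra.Bundles using (CommutativeSemiring)
open import Function using (_∘_; id; _⇔_; mk⇔; Equivalence)
open import Data.Bool using (Bool; true; false; T; not; if_then_else_; _∧_)
open import Data.Bool.Properties using (T?; T-≡; T-∧; ⇔→≡)
open import Data.Nat as ℕ using (ℕ; zero; suc; pred; _+_; _≤_; _<_; _<ᵇ_; _≡ᵇ_; z≤n; s≤s)
open import Data.Nat.Properties as ℕP using (<ᵇ⇒<; <⇒<ᵇ)
open import Data.Nat.ListAction using (sum)
open import Data.Nat.ListAction.Properties using (sum-↭)
open import Data.Integer as ℤ using (ℤ; +_; -[1+_]; ∣_∣)
open import Data.List as List using (List; []; _∷_; _++_; map; length; filter; iterate; upTo)
import Data.List.Properties as ListP
open import Data.List.Membership.Propositional using (_∈_; _∉_)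
open import Data.List.Membership.Propositional.Properties
open import Data.List.Relation.Unary.Any as Any using (here; there)
open import Data.List.Relation.Unary.All as All using (All; []; _∷_)
open import Data.List.Relation.Unary.AllPairs as AllPairs using (AllPairs; []; _∷_)
import Data.List.Relation.Unary.AllPairs.Properties as AllPairsP
open import Data.List.Relation.Unary.Unique.Propositional using (Unique)
import Data.List.Relation.Unary.Unique.Propositional.Properties as UniqueP
open import Data.List.Relation.Binary.Permutation.Propositional as Perm
  using (_↭_; ↭-sym; ↭-trans; ↭-refl)
import Data.List.Relation.Binary.Permutation.Propositional.Properties as PermP
import Data.List.Relation.Binary.Permutation.Setoid.Properties as PermS
open import Data.Product using (∃; _×_; _,_; proj₁; proj₂)
open import Data.Sum as Sum using (_⊎_; inj₁; inj₂)
open import Data.Empty using (⊥-elim)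
open import Data.Unit using (tt)
open import Relation.Binary using (tri<; tri≈; tri>)
open import Relation.Nullary using (¬_; ¬?; Dec; yes; no; does)
open import Relation.Nullary.Decidable using (dec-true; dec-false; does-⇔)
open import Data.List.Membership.DecPropositional ℕ._≟_ using () renaming (_∈?_ to _∈ℕ?_)
open import Data.List.Membership.DecPropositional ℤ._≟_ using () renaming (_∈?_ to _∈ℤ?_)
open import Data.List.Membership.Propositional.Properties.WithK using (unique∧set⇒bag)
open import Data.List.Relation.Binary.BagAndSetEquality using (∼bag⇒↭)
open import Relation.Binary.PropositionalEquality
  using (_≡_; _≢_; refl; sym; trans; cong; cong₂; subst; subst₂)
  renaming (setoid to ≡-setoid; isEquivalence to ≡-isEquivalence)
open import Relation.Binary.PropositionalEquality using (module ≡-Reasoning)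

_≺_ : ℤ → ℤ → Set
x ≺ y = T (ltL x y)

≺-irrefl : ∀ x → ¬ x ≺ x
≺-irrefl -[1+ a ] p = ℕP.<-irrefl refl (<ᵇ⇒< a a p)
≺-irrefl (+ a)    p = ℕP.<-irrefl refl (<ᵇ⇒< a a p)

≺-trans : ∀ x y z → x ≺ y → y ≺ z → x ≺ z
≺-trans -[1+ a ] -[1+ b ] -[1+ c ] p q = <⇒<ᵇ (ℕP.<-trans (<ᵇ⇒< a b p) (<ᵇ⇒< b c q))
≺-trans -[1+ a ] -[1+ b ] (+ c)    p q = tt
≺-trans -[1+ a ] (+ b)    (+ c)    p q = tt
≺-trans (+ a)    (+ b)    (+ c)    p q = <⇒<ᵇ (ℕP.<-trans (<ᵇ⇒< a b p) (<ᵇ⇒< b c q))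
≺-trans -[1+ a ] (+ b)    -[1+ c ] p ()
≺-trans (+ a)    -[1+ b ] z        () q
≺-trans (+ a)    (+ b)    -[1+ c ] p ()

<ᵇ-trichotomy : ∀ a b → T (a <ᵇ b) ⊎ (a ≡ b ⊎ T (b <ᵇ a))
<ᵇ-trichotomy a b with ℕP.<-cmp a b
... | tri< a<b _ _ = inj₁ (<⇒<ᵇ a<b)
... | tri≈ _ a≡b _ = inj₂ (inj₁ a≡b)
... | tri> _ _ b<a = inj₂ (inj₂ (<⇒<ᵇ b<a))

≺-trichotomy : ∀ x y → x ≺ y ⊎ (x ≡ y ⊎ y ≺ x)
≺-trichotomy -[1+ a ] (+ b)    = inj₁ tt
≺-trichotomy (+ a)    -[1+ b ] = inj₂ (inj₂ tt)
≺-trichotomy -[1+ a ] -[1+ b ] = Sum.map₂ (Sum.map₁ (cong -[1+_])) (<ᵇ-trichotomy a b)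
≺-trichotomy (+ a)    (+ b)    = Sum.map₂ (Sum.map₁ (cong (+_))) (<ᵇ-trichotomy a b)

module _ {A : Set} {P Q : A → Set} (P? : ∀ a → Dec (P a)) (Q? : ∀ a → Dec (Q a))
         (P⇒Q : ∀ a → P a → Q a) where

  length-filter-mono : ∀ xs → length (filter P? xs) ≤ length (filter Q? xs)
  length-filter-mono [] = z≤n
  length-filter-mono (a ∷ xs) with P? a | Q? a
  ... | yes p | yes q = s≤s (length-filter-mono xs)
  ... | yes p | no ¬q = ⊥-elim (¬q (P⇒Q a p))
  ... | no ¬p | yes q = ℕP.m≤n⇒m≤1+n (length-filter-mono xs)
  ... | no ¬p | no ¬q = length-filter-mono xs

  length-filter-strict : ∀ {z} xs → z ∈ xs → Q z → ¬ P z →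
                         length (filter P? xs) < length (filter Q? xs)
  length-filter-strict (a ∷ xs) (here refl) qz ¬pz with P? a | Q? a
  ... | yes p | _     = ⊥-elim (¬pz p)
  ... | no ¬p | yes q = s≤s (length-filter-mono xs)
  ... | no ¬p | no ¬q = ⊥-elim (¬q qz)
  length-filter-strict (a ∷ xs) (there z∈) qz ¬pz with P? a | Q? a
  ... | yes p | yes q = s≤s (length-filter-strict xs z∈ qz ¬pz)
  ... | yes p | no ¬q = ⊥-elim (¬q (P⇒Q a p))
  ... | no ¬p | yes q = ℕP.m≤n⇒m≤1+n (length-filter-strict xs z∈ qz ¬pz)
  ... | no ¬p | no ¬q = length-filter-strict xs z∈ qz ¬pz

rank : List ℤ → ℤ → ℕ
rank w x = length (filter (λ y → T? (ltL y x)) w)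

stLetter : List ℤ → ℤ → ℕ
stLetter w x = suc (rank w x)

rank-↭ : ∀ {w w′} x → w ↭ w′ → rank w x ≡ rank w′ x
rank-↭ x p = PermP.↭-length (PermP.filter-↭ (λ y → T? (ltL y x)) p)

rank-strict : ∀ w {x y} → y ∈ w → y ≺ x → rank w y < rank w x
rank-strict w {x} {y} y∈w y≺x =
  length-filter-strict (λ a → T? (ltL a y)) (λ a → T? (ltL a x))
    (λ a a≺y → ≺-trans a y x a≺y y≺x) w y∈w y≺x (≺-irrefl y)

rank-mono : ∀ w {x y} → ¬ y ≺ x → rank w x ≤ rank w y
rank-mono w {x} {y} y⊀x with ≺-trichotomy x y
... | inj₁ x≺y = length-filter-mono (λ a → T? (ltL a x)) (λ a → T? (ltL a y))
                   (λ a a≺x → ≺-trans a x y a≺x x≺y) w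
... | inj₂ (inj₁ refl) = ℕP.≤-refl
... | inj₂ (inj₂ y≺x) = ⊥-elim (y⊀x y≺x)

stLetter-injective : ∀ w {x y} → x ∈ w → y ∈ w → stLetter w x ≡ stLetter w y → x ≡ y
stLetter-injective w {x} {y} x∈w y∈w eq with ≺-trichotomy x y
... | inj₁ x≺y        = ⊥-elim (ℕP.<-irrefl (ℕP.suc-injective eq) (rank-strict w x∈w x≺y))
... | inj₂ (inj₁ x≡y) = x≡y
... | inj₂ (inj₂ y≺x) = ⊥-elim (ℕP.<-irrefl (sym (ℕP.suc-injective eq)) (rank-strict w y∈w y≺x))

stLetter-preserves-order : ∀ w x y → y ∈ w → ltL y x ≡ ltℕ (stLetter w y) (stLetter w x)
stLetter-preserves-order w x y y∈w = ⇔→≡ {z = true} (mk⇔ forward backward)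
  where
  forward : ltL y x ≡ true → (rank w y <ᵇ rank w x) ≡ true
  forward eq = Equivalence.to T-≡ (<⇒<ᵇ (rank-strict w y∈w (Equivalence.from T-≡ eq)))
  backward : (rank w y <ᵇ rank w x) ≡ true → ltL y x ≡ true
  backward eq with T? (ltL y x)
  ... | yes y≺x = Equivalence.to T-≡ y≺x
  ... | no y⊀x  = ⊥-elim (ℕP.<⇒≱ (<ᵇ⇒< _ _ (Equivalence.from T-≡ eq)) (rank-mono w y⊀x))

-- (1) Standardization preserves descent sets: comparing two letters of w is the
-- same as comparing their standardized values.

desSetFrom-st : ∀ w i v → All (_∈ w) v →
                desSetFrom ltL i v ≡ desSetFrom ltℕ i (map (stLetter w) v)
desSetFrom-st w i []          _ = refl
desSetFrom-st w i (x ∷ [])    _ = refl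
desSetFrom-st w i (x ∷ y ∷ v) (_ ∷ y∈w ∷ v⊆w) =
  cong₂ (λ b D → if b then i ∷ D else D)
        (stLetter-preserves-order w x y y∈w)
        (desSetFrom-st w (suc i) (y ∷ v) (y∈w ∷ v⊆w))

Des-st : ∀ w → Des ltL w ≡ Des ltℕ (st w)
Des-st w = desSetFrom-st w 1 w (All.tabulate id)

range : ℕ → ℕ → List ℕ
range = iterate suc

∈-range⁻ : ∀ m k {i} → i ∈ range m k → m ≤ i × i < m + k
∈-range⁻ m (suc k) (here refl) = ℕP.≤-refl , ℕP.m<m+n m ℕ.z<s
∈-range⁻ m (suc k) {i} (there p) with ∈-range⁻ (suc m) k p
... | m<i , i<m+k = ℕP.<⇒≤ m<i , subst (i <_) (sym (ℕP.+-suc m k)) i<m+k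

∈-range⁺ : ∀ m k {i} → m ≤ i → i < m + k → i ∈ range m k
∈-range⁺ m zero    {i} m≤i i<m+0 = ⊥-elim (ℕP.<-irrefl refl
  (ℕP.<-≤-trans i<m+0 (subst (_≤ i) (sym (ℕP.+-identityʳ m)) m≤i)))
∈-range⁺ m (suc k) {i} m≤i i<m+k with m ℕ.≟ i
... | yes refl = here refl
... | no m≢i   = there (∈-range⁺ (suc m) k (ℕP.≤∧≢⇒< m≤i m≢i) (subst (i <_) (ℕP.+-suc m k) i<m+k))

upTo≡range : ∀ n → upTo n ≡ range 0 n
upTo≡range n = shifted id 0 n (λ _ → refl)
  where
  shifted : ∀ (f : ℕ → ℕ) m k → (∀ i → f i ≡ m + i) → List.applyUpTo f k ≡ range m k
  shifted f m zero    f≗ = refl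
  shifted f m (suc k) f≗ = cong₂ _∷_ (trans (f≗ 0) (ℕP.+-identityʳ m))
    (shifted (f ∘ suc) (suc m) k (λ i → trans (f≗ (suc i)) (ℕP.+-suc m i)))

oneTo≡range : ∀ n → oneTo n ≡ map suc (range 0 n)
oneTo≡range n = cong (map suc) (upTo≡range n)

-- Sign vectors: s at index i is true when the letter of absolute value i+1 is
-- barred.  positions m s lists the indices (counted from m) where s is true.

positions : ℕ → List Bool → List ℕ
positions m []          = []
positions m (true ∷ s)  = m ∷ positions (suc m) s
positions m (false ∷ s) = positions (suc m) s

positions⊆range : ∀ m s {i} → i ∈ positions m s → i ∈ range m (length s)
positions⊆range m (true ∷ s)  (here refl) = here refl
positions⊆range m (true ∷ s)  (there p)   = there (positions⊆range (suc m) s p)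
positions⊆range m (false ∷ s) p           = there (positions⊆range (suc m) s p)

positions-lower : ∀ m s {i} → i ∈ positions m s → m ≤ i
positions-lower m s p = proj₁ (∈-range⁻ m (length s) (positions⊆range m s p))

positions-bound : ∀ s {i} → i ∈ positions 0 s → i < length s
positions-bound s p = proj₂ (∈-range⁻ 0 (length s) (positions⊆range 0 s p))

positions-sorted : ∀ m s → AllPairs _<_ (positions m s)
positions-sorted m []          = []
positions-sorted m (true ∷ s)  = All.tabulate (positions-lower (suc m) s) ∷ positions-sorted (suc m) s
positions-sorted m (false ∷ s) = positions-sorted (suc m) s

positions-partition : ∀ m s → positions m s ++ positions m (map not s) ↭ range m (length s)
positions-partition m []          = ↭-refl
positions-partition m (true ∷ s)  = Perm.prep m (positions-partition (suc m) s)
positions-partition m (false ∷ s) =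
  ↭-trans (PermP.shift m (positions (suc m) s) (positions (suc m) (map not s)))
          (Perm.prep m (positions-partition (suc m) s))

module _ {P : ℕ → Set} (P? : ∀ i → Dec (P i)) where

  ∈-positions-of⁺ : ∀ m k {i} → i ∈ range m k → P i → i ∈ positions m (map (does ∘ P?) (range m k))
  ∈-positions-of⁺ m (suc k) i∈ pi with P? m | i∈
  ... | yes _  | here refl = here refl
  ... | no ¬pm | here refl = ⊥-elim (¬pm pi)
  ... | yes _  | there i∈′ = there (∈-positions-of⁺ (suc m) k i∈′ pi)
  ... | no _   | there i∈′ = ∈-positions-of⁺ (suc m) k i∈′ pi

  ∈-positions-of⁻ : ∀ m k {i} → i ∈ positions m (map (does ∘ P?) (range m k)) → i ∈ range m k × P i
  ∈-positions-of⁻ m (suc k) i∈ with P? m | i∈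
  ... | yes pm | here refl = here refl , pm
  ... | yes _  | there i∈′ with ∈-positions-of⁻ (suc m) k i∈′
  ...   | i∈R , pi = there i∈R , pi
  ∈-positions-of⁻ m (suc k) i∈ | no _ | i∈′ with ∈-positions-of⁻ (suc m) k i∈′
  ...   | i∈R , pi = there i∈R , pi

indicator-positions : ∀ m s → map (λ i → does (i ∈ℕ? positions m s)) (range m (length s)) ≡ s
indicator-positions m [] = refl
indicator-positions m (true ∷ s) =
  cong₂ _∷_ (dec-true (m ∈ℕ? positions m (true ∷ s)) (here refl))
    (trans (ListP.map-cong-local (All.tabulate drop-head)) (indicator-positions (suc m) s))
  where
  drop-head : ∀ {i} → i ∈ range (suc m) (length s) →
              does (i ∈ℕ? (m ∷ positions (suc m) s)) ≡ does (i ∈ℕ? positions (suc m) s)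
  drop-head {i} i∈ = does-⇔ (mk⇔ to there) (i ∈ℕ? (m ∷ positions (suc m) s)) (i ∈ℕ? positions (suc m) s)
    where
    to : i ∈ m ∷ positions (suc m) s → i ∈ positions (suc m) s
    to (here refl) = ⊥-elim (ℕP.<-irrefl refl (proj₁ (∈-range⁻ (suc m) (length s) i∈)))
    to (there p)   = p
indicator-positions m (false ∷ s) =
  cong₂ _∷_ (dec-false (m ∈ℕ? positions (suc m) s) (λ p → ℕP.<-irrefl refl (positions-lower (suc m) s p)))
    (indicator-positions (suc m) s)

signVectors : ℕ → List (List Bool)
signVectors zero    = [] ∷ []
signVectors (suc k) = map (false ∷_) (signVectors k) ++ map (true ∷_) (signVectors k)

∈-signVectors⁺ : ∀ k s → length s ≡ k → s ∈ signVectors k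
∈-signVectors⁺ zero    []          refl = here refl
∈-signVectors⁺ (suc k) (false ∷ s) eq =
  ∈-++⁺ˡ (∈-map⁺ (false ∷_) (∈-signVectors⁺ k s (ℕP.suc-injective eq)))
∈-signVectors⁺ (suc k) (true ∷ s)  eq =
  ∈-++⁺ʳ (map (false ∷_) (signVectors k)) (∈-map⁺ (true ∷_) (∈-signVectors⁺ k s (ℕP.suc-injective eq)))

∈-signVectors⁻ : ∀ k {s} → s ∈ signVectors k → length s ≡ k
∈-signVectors⁻ zero    (here refl) = refl
∈-signVectors⁻ (suc k) p with ∈-++⁻ (map (false ∷_) (signVectors k)) p
... | inj₁ q with ∈-map⁻ (false ∷_) q
...   | _ , r , refl = cong suc (∈-signVectors⁻ k r)
∈-signVectors⁻ (suc k) p | inj₂ q with ∈-map⁻ (true ∷_) q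
...   | _ , r , refl = cong suc (∈-signVectors⁻ k r)

signVectors-unique : ∀ k → Unique (signVectors k)
signVectors-unique zero    = [] ∷ []
signVectors-unique (suc k) =
  UniqueP.++⁺ (UniqueP.map⁺ ListP.∷-injectiveʳ (signVectors-unique k))
              (UniqueP.map⁺ ListP.∷-injectiveʳ (signVectors-unique k))
              (λ { (p , q) → different-heads p q })
  where
  different-heads : ∀ {v} → v ∈ map (false ∷_) (signVectors k) → v ∉ map (true ∷_) (signVectors k)
  different-heads p q with ∈-map⁻ (false ∷_) p | ∈-map⁻ (true ∷_) q
  ... | _ , _ , refl | _ , _ , ()

bar : ℕ → ℤ
bar i = -[1+ i ]

plain : ℕ → ℤ
plain i = + suc i

letters : List Bool → List ℤ
letters s = map bar (positions 0 s) ++ map plain (positions 0 (map not s))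

∈-letters⁻ : ∀ s {x} → x ∈ letters s →
             (∃ λ i → x ≡ bar i × i ∈ positions 0 s) ⊎ (∃ λ i → x ≡ plain i × i ∈ positions 0 (map not s))
∈-letters⁻ s p with ∈-++⁻ (map bar (positions 0 s)) p
... | inj₁ q = inj₁ (let i , i∈ , eq = ∈-map⁻ bar q in i , eq , i∈)
... | inj₂ q = inj₂ (let i , i∈ , eq = ∈-map⁻ plain q in i , eq , i∈)

bar∈letters : ∀ s {i} → i ∈ positions 0 s → bar i ∈ letters s
bar∈letters s p = ∈-++⁺ˡ (∈-map⁺ bar p)

plain∈letters : ∀ s {i} → i ∈ positions 0 (map not s) → plain i ∈ letters s
plain∈letters s p = ∈-++⁺ʳ (map bar (positions 0 s)) (∈-map⁺ plain p)

letters-sorted : ∀ s → AllPairs _≺_ (letters s)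
letters-sorted s =
  AllPairsP.++⁺ (AllPairsP.map⁺ (AllPairs.map <⇒<ᵇ (positions-sorted 0 s)))
                (AllPairsP.map⁺ (AllPairs.map <⇒<ᵇ (positions-sorted 0 (map not s))))
                (All.tabulate λ x∈ → All.tabulate λ y∈ → bar≺plain x∈ y∈)
  where
  bar≺plain : ∀ {x y} → x ∈ map bar (positions 0 s) → y ∈ map plain (positions 0 (map not s)) → x ≺ y
  bar≺plain x∈ y∈ with ∈-map⁻ bar x∈ | ∈-map⁻ plain y∈
  ... | _ , _ , refl | _ , _ , refl = tt

letters-unique : ∀ s → Unique (letters s)
letters-unique s = AllPairs.map (λ {x} x≺y x≡y → ≺-irrefl x (subst (x ≺_) (sym x≡y) x≺y)) (letters-sorted s)

∣letters∣ : ∀ s → map ∣_∣ (letters s) ↭ oneTo (length s)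
∣letters∣ s = subst₂ _↭_ (sym absolute-values) (sym (oneTo≡range (length s)))
                (PermP.map⁺ suc (positions-partition 0 s))
  where
  absolute-values : map ∣_∣ (letters s) ≡ map suc (positions 0 s ++ positions 0 (map not s))
  absolute-values = trans (ListP.map-++ ∣_∣ (map bar (positions 0 s)) _)
    (trans (cong₂ _++_ (sym (ListP.map-∘ (positions 0 s))) (sym (ListP.map-∘ (positions 0 (map not s)))))
           (sym (ListP.map-++ suc (positions 0 s) _)))

length-letters : ∀ s → length (letters s) ≡ length s
length-letters s = trans (sym (ListP.length-map ∣_∣ (letters s)))
  (trans (PermP.↭-length (∣letters∣ s))
         (trans (ListP.length-map suc (upTo (length s))) (ListP.length-upTo (length s))))

letters⊆alphabet : ∀ s {x} → x ∈ letters s → x ∈ alphabet (length s)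
letters⊆alphabet s p with ∈-letters⁻ s p
... | inj₁ (i , refl , i∈) = ∈-++⁺ˡ (∈-map⁺ bar (∈-upTo⁺ (positions-bound s i∈)))
... | inj₂ (i , refl , i∈) = ∈-++⁺ʳ (map bar (upTo (length s)))
  (∈-map⁺ plain (∈-upTo⁺ (subst (i <_) (ListP.length-map not s) (positions-bound (map not s) i∈))))

barred-letters : ∀ s → filter (λ x → T? (isNeg x)) (letters s) ≡ map bar (positions 0 s)
barred-letters s = barred-prefix (positions 0 s) (positions 0 (map not s))
  where
  barred-prefix : ∀ N P → filter (λ x → T? (isNeg x)) (map bar N ++ map plain P) ≡ map bar N
  barred-prefix (i ∷ N) P       = cong (bar i ∷_) (barred-prefix N P)
  barred-prefix []      (i ∷ P) = barred-prefix [] P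
  barred-prefix []      []      = refl

-- nth L j is the j-th entry of L (counting from 0; a dummy value past the end).

nth : List ℤ → ℕ → ℤ
nth []      _       = + 0
nth (x ∷ _) zero    = x
nth (_ ∷ L) (suc j) = nth L j

nth-∈ : ∀ L {j} → j < length L → nth L j ∈ L
nth-∈ (x ∷ L) {zero}  _           = here refl
nth-∈ (x ∷ L) {suc j} (s≤s j<∣L∣) = there (nth-∈ L j<∣L∣)

map-nth : ∀ L → map (nth L) (range 0 (length L)) ≡ L
map-nth []      = refl
map-nth (x ∷ L) = cong (x ∷_) (trans (shift-index 0 (length L)) (map-nth L))
  where
  shift-index : ∀ m k → map (nth (x ∷ L)) (range (suc m) k) ≡ map (nth L) (range m k)
  shift-index m zero    = refl
  shift-index m (suc k) = cong (nth L m ∷_) (shift-index (suc m) k)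

rank-nth : ∀ L {j} → AllPairs _≺_ L → j < length L → rank L (nth L j) ≡ j
rank-nth (x ∷ L) {zero} (x≺L ∷ _) _ with ltL x x in eq
... | true  = ⊥-elim (≺-irrefl x (subst T (sym eq) tt))
... | false = nothing-below L (All.map (λ {y} x≺y y≺x → ≺-irrefl x (≺-trans x y x x≺y y≺x)) x≺L)
  where
  nothing-below : ∀ W → All (λ y → ¬ y ≺ x) W → rank W x ≡ 0
  nothing-below []      []          = refl
  nothing-below (y ∷ W) (y⊀x ∷ W⊀x) with ltL y x
  ... | true  = ⊥-elim (y⊀x tt)
  ... | false = nothing-below W W⊀x
rank-nth (x ∷ L) {suc j} (x≺L ∷ L-sorted) (s≤s j<∣L∣) with ltL x (nth L j) in eq
... | true  = cong suc (rank-nth L L-sorted j<∣L∣)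
... | false = ⊥-elim (subst T eq (All.lookup x≺L (nth-∈ L j<∣L∣)))

countℕ-here : ∀ j v → countℕ j (j ∷ v) ≡ suc (countℕ j v)
countℕ-here j v rewrite Equivalence.to T-≡ (ℕP.≡⇒≡ᵇ j j refl) = refl

countℕ-there : ∀ {j k} v → j ≢ k → countℕ j (k ∷ v) ≡ countℕ j v
countℕ-there {j} {k} v j≢k with j ≡ᵇ k in eq
... | true  = ⊥-elim (j≢k (ℕP.≡ᵇ⇒≡ j k (subst T (sym eq) tt)))
... | false = refl

countℕ-↭ : ∀ j {u v} → u ↭ v → countℕ j u ≡ countℕ j v
countℕ-↭ j Perm.refl = refl
countℕ-↭ j (Perm.prep x p) with j ≡ᵇ x
... | true  = cong suc (countℕ-↭ j p)
... | false = countℕ-↭ j p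
countℕ-↭ j (Perm.swap x y p) with j ≡ᵇ x | j ≡ᵇ y
... | true  | true  = cong (suc ∘ suc) (countℕ-↭ j p)
... | true  | false = cong suc (countℕ-↭ j p)
... | false | true  = cong suc (countℕ-↭ j p)
... | false | false = countℕ-↭ j p
countℕ-↭ j (Perm.trans p q) = trans (countℕ-↭ j p) (countℕ-↭ j q)

countℕ-positive : ∀ j v → 1 ≤ countℕ j v → j ∈ v
countℕ-positive j (k ∷ v) c≥1 with j ℕ.≟ k
... | yes refl = here refl
... | no j≢k   = there (countℕ-positive j v (subst (1 ≤_) (countℕ-there v j≢k) c≥1))

countℕ-∉ : ∀ j v → j ∉ v → countℕ j v ≡ 0
countℕ-∉ j []      _   = refl
countℕ-∉ j (k ∷ v) j∉ =
  trans (countℕ-there v (λ j≡k → j∉ (here j≡k))) (countℕ-∉ j v (j∉ ∘ there))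

countℕ-unique : ∀ j v → Unique v → j ∈ v → countℕ j v ≡ 1
countℕ-unique j (k ∷ v) (k∉v ∷ _) (here refl) =
  trans (countℕ-here j v) (cong suc (countℕ-∉ j v (λ j∈v → All.lookup k∉v j∈v refl)))
countℕ-unique j (k ∷ v) (k∉v ∷ v-unique) (there j∈v) =
  trans (countℕ-there v (λ { refl → All.lookup k∉v j∈v refl })) (countℕ-unique j v v-unique j∈v)

extract : ∀ xs u → Unique xs → (∀ k → k ∈ xs → 1 ≤ countℕ k u) → ∃ λ r → u ↭ xs ++ r
extract []       u _                 _       = u , ↭-refl
extract (x ∷ xs) u (x∉xs ∷ xs-unique) xs⊆u
  with a , b , refl ← ∈-∃++ (countℕ-positive x u (xs⊆u x (here refl))) =
  let r , ab↭ = extract xs (a ++ b) xs-unique xs⊆ab in r , ↭-trans (PermP.shift x a b) (Perm.prep x ab↭)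
  where
  -- removing the occurrence of x does not affect the counts of the other elements of xs
  xs⊆ab : ∀ k → k ∈ xs → 1 ≤ countℕ k (a ++ b)
  xs⊆ab k k∈xs = subst (1 ≤_)
    (trans (countℕ-↭ k (PermP.shift x a b)) (countℕ-there (a ++ b) (λ { refl → All.lookup x∉xs k∈xs refl })))
    (xs⊆u k (there k∈xs))

oneTo-unique : ∀ n → Unique (oneTo n)
oneTo-unique n = UniqueP.map⁺ ℕP.suc-injective (UniqueP.upTo⁺ n)

length-oneTo : ∀ n → length (oneTo n) ≡ n
length-oneTo n = trans (ListP.length-map suc (upTo n)) (ListP.length-upTo n)

T-foldr-∧ : ∀ (f : ℕ → Bool) xs → T (List.foldr (λ k b → f k ∧ b) true xs) ⇔ All (T ∘ f) xs
T-foldr-∧ f []       = mk⇔ (λ _ → []) (λ _ → tt)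
T-foldr-∧ f (x ∷ xs) = mk⇔
  (λ p → let fx , rest = Equivalence.to (T-∧ {f x}) p in fx ∷ Equivalence.to (T-foldr-∧ f xs) rest)
  (λ { (fx ∷ rest) → Equivalence.from (T-∧ {f x}) (fx , Equivalence.from (T-foldr-∧ f xs) rest) })

rest-empty : ∀ {A : Set} (xs r : List A) → length (xs ++ r) ≡ length xs → r ≡ []
rest-empty []       []      _  = refl
rest-empty (_ ∷ xs) r       eq = rest-empty xs r (ℕP.suc-injective eq)

IsPerm⇒↭ : ∀ n u → IsPerm n u → u ↭ oneTo n
IsPerm⇒↭ n u isPerm
  with length-ok , counts-ok ← Equivalence.to (T-∧ {length u ≡ᵇ n}) isPerm
  with r , u↭ ← extract (oneTo n) u (oneTo-unique n) (λ k k∈ →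
         ℕP.≤-reflexive (sym (ℕP.≡ᵇ⇒≡ _ 1 (All.lookup (Equivalence.to (T-foldr-∧ _ (oneTo n)) counts-ok) k∈))))
  with refl ← rest-empty (oneTo n) r (trans (sym (PermP.↭-length u↭))
                (trans (ℕP.≡ᵇ⇒≡ _ _ length-ok) (sym (length-oneTo n))))
  = subst (u ↭_) (ListP.++-identityʳ (oneTo n)) u↭

↭⇒IsPerm : ∀ n v → v ↭ oneTo n → IsPerm n v
↭⇒IsPerm n v v↭ = Equivalence.from (T-∧ {length v ≡ᵇ n})
  ( ℕP.≡⇒≡ᵇ _ _ (trans (PermP.↭-length v↭) (length-oneTo n))
  , Equivalence.from (T-foldr-∧ _ (oneTo n)) (All.tabulate λ {k} k∈ →
      ℕP.≡⇒≡ᵇ _ _ (trans (countℕ-↭ k v↭) (countℕ-unique k (oneTo n) (oneTo-unique n) k∈))))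

∈-oneTo⁻ : ∀ n {j} → j ∈ oneTo n → ∃ λ i → j ≡ suc i × i < n
∈-oneTo⁻ n {j} j∈ with ∈-map⁻ suc (subst (j ∈_) (oneTo≡range n) j∈)
... | i , i∈ , refl = i , refl , proj₂ (∈-range⁻ 0 n i∈)

∈-oneTo⁺ : ∀ n {i} → i < n → suc i ∈ oneTo n
∈-oneTo⁺ n i<n = ∈-map⁺ suc (∈-upTo⁺ i<n)

wordsOf-complete : ∀ k A w → length w ≡ k → All (_∈ A) w → w ∈ wordsOf k A
wordsOf-complete zero    A []      refl []          = here refl
wordsOf-complete (suc k) A (a ∷ w) eq   (a∈A ∷ w⊆A) =
  ∈-concatMap⁺ (λ b → map (b ∷_) (wordsOf k A))
    (Any.map (λ { refl → ∈-map⁺ (a ∷_) (wordsOf-complete k A w (ℕP.suc-injective eq) w⊆A) }) a∈A)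

eqListℕ-refl : ∀ v → T (eqListℕ v v)
eqListℕ-refl []      = tt
eqListℕ-refl (x ∷ v) = Equivalence.from (T-∧ {x ≡ᵇ x}) (ℕP.≡⇒≡ᵇ x x refl , eqListℕ-refl v)

eqListℕ-sound : ∀ v v′ → T (eqListℕ v v′) → v ≡ v′
eqListℕ-sound []      []       _  = refl
eqListℕ-sound (x ∷ v) (y ∷ v′) eq with Equivalence.to (T-∧ {x ≡ᵇ y}) eq
... | x≡y , v≡v′ = cong₂ _∷_ (ℕP.≡ᵇ⇒≡ x y x≡y) (eqListℕ-sound v v′ v≡v′)

φ : List ℕ → List Bool → List ℤ
φ u s = map (nth (letters s) ∘ pred) u

module _ {n u} (u↭ : u ↭ oneTo n) (s : List Bool) (∣s∣≡n : length s ≡ n) where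

  ∣letters∣≡n : length (letters s) ≡ n
  ∣letters∣≡n = trans (length-letters s) ∣s∣≡n

  φ-↭ : φ u s ↭ letters s
  φ-↭ = ↭-trans (PermP.map⁺ _ u↭) (Perm.↭-reflexive all-letters)
    where
    open ≡-Reasoning
    all-letters : map (nth (letters s) ∘ pred) (oneTo n) ≡ letters s
    all-letters = begin
      map (nth (letters s) ∘ pred) (oneTo n)                 ≡⟨ cong (map _) (oneTo≡range n) ⟩
      map (nth (letters s) ∘ pred) (map suc (range 0 n))     ≡⟨ ListP.map-∘ (range 0 n) ⟨
      map (nth (letters s)) (range 0 n)                      ≡⟨ cong (map (nth (letters s)) ∘ range 0) ∣letters∣≡n ⟨
      map (nth (letters s)) (range 0 (length (letters s)))   ≡⟨ map-nth (letters s) ⟩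
      letters s                                              ∎

  -- The entry of φ u s at a position where u has value i+1 is the letter of rank i.
  st-φ : st (φ u s) ≡ u
  st-φ = trans (sym (ListP.map-∘ u)) (trans (ListP.map-cong-local (All.tabulate st-entry)) (ListP.map-id u))
    where
    st-entry : ∀ {j} → j ∈ u → stLetter (φ u s) (nth (letters s) (pred j)) ≡ j
    st-entry j∈u with ∈-oneTo⁻ n (PermP.∈-resp-↭ u↭ j∈u)
    ... | i , refl , i<n = cong suc (trans (rank-↭ (nth (letters s) i) φ-↭)
            (rank-nth (letters s) (letters-sorted s) (subst (i <_) (sym ∣letters∣≡n) i<n)))

  φ∈Bu : φ u s ∈ Bu n u
  φ∈Bu = ∈-filter⁺ (λ w → T? (eqListℕ (st w) u))
    (∈-filter⁺ (λ w → T? (inB n w))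
       (wordsOf-complete n (alphabet n) (φ u s) length-φ
          (All.tabulate λ x∈ → subst (λ k → _ ∈ alphabet k) ∣s∣≡n (letters⊆alphabet s (PermP.∈-resp-↭ φ-↭ x∈))))
       (↭⇒IsPerm n (map ∣_∣ (φ u s))
          (↭-trans (PermP.map⁺ ∣_∣ φ-↭) (subst (λ k → map ∣_∣ (letters s) ↭ oneTo k) ∣s∣≡n (∣letters∣ s)))))
    (subst (λ v → T (eqListℕ v u)) (sym st-φ) (eqListℕ-refl u))
    where
    length-φ : length (φ u s) ≡ n
    length-φ = trans (ListP.length-map _ u) (trans (PermP.↭-length u↭) (length-oneTo n))

  Des-φ : Des ltL (φ u s) ≡ Des ltℕ u
  Des-φ = trans (Des-st (φ u s)) (cong (Des ltℕ) st-φ)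

  -- (3) φ u s has the same barred letters as  letters s , namely the bar i with sᵢ true.
  negCount-φ : negCount (φ u s) ≡ length (positions 0 s)
  negCount-φ = trans (PermP.↭-length (PermP.filter-↭ (λ x → T? (isNeg x)) φ-↭))
    (trans (cong length (barred-letters s)) (ListP.length-map bar (positions 0 s)))

  negSum-φ : negSum (φ u s) ≡ sum (map suc (positions 0 s))
  negSum-φ = trans (sum-↭ (PermP.map⁺ ∣_∣ (PermP.filter-↭ (λ x → T? (isNeg x)) φ-↭)))
    (cong sum (trans (cong (map ∣_∣) (barred-letters s)) (sym (ListP.map-∘ (positions 0 s)))))

signs : ℕ → List ℤ → List Bool
signs n w = map (λ i → does (bar i ∈ℤ? w)) (range 0 n)

length-signs : ∀ n w → length (signs n w) ≡ n
length-signs n w = trans (ListP.length-map _ (range 0 n)) (ListP.length-iterate suc 0 n)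

signs-↭ : ∀ n {w w′} → w ↭ w′ → signs n w ≡ signs n w′
signs-↭ n w↭w′ = ListP.map-cong (λ i →
  does-⇔ (mk⇔ (PermP.∈-resp-↭ w↭w′) (PermP.∈-resp-↭ (↭-sym w↭w′))) (bar i ∈ℤ? _) (bar i ∈ℤ? _)) (range 0 n)

signs-letters : ∀ s → signs (length s) (letters s) ≡ s
signs-letters s = trans (ListP.map-cong same-test (range 0 (length s))) (indicator-positions 0 s)
  where
  barred : ∀ {i} → bar i ∈ letters s → i ∈ positions 0 s
  barred p with ∈-letters⁻ s p
  ... | inj₁ (_ , refl , i∈) = i∈
  same-test : ∀ i → does (bar i ∈ℤ? letters s) ≡ does (i ∈ℕ? positions 0 s)
  same-test i = does-⇔ (mk⇔ barred (bar∈letters s)) (bar i ∈ℤ? letters s) (i ∈ℕ? positions 0 s)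

unbarred-signs : ∀ n w → map not (signs n w) ≡ map (λ i → does (¬? (bar i ∈ℤ? w))) (range 0 n)
unbarred-signs n w = sym (ListP.map-∘ (range 0 n))

-- If map g w is duplicate-free, g is injective on the members of w (for w ∈ Bₙ
-- and g = ∣_∣: distinct letters of a signed permutation have distinct absolute values).
collision : ∀ {A B : Set} (g : A → B) (w : List A) {x y} →
            Unique (map g w) → x ∈ w → y ∈ w → g x ≡ g y → x ≡ y
collision g (a ∷ w) _             (here refl) (here refl) _ = refl
collision g (a ∷ w) (a∉ ∷ _)      (here refl) (there y∈)  e = ⊥-elim (All.lookup a∉ (∈-map⁺ g y∈) e)
collision g (a ∷ w) (a∉ ∷ _)      (there x∈)  (here refl) e = ⊥-elim (All.lookup a∉ (∈-map⁺ g x∈) (sym e))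
collision g (a ∷ w) (_ ∷ unique)  (there x∈)  (there y∈)  e = collision g w unique x∈ y∈ e

↭-letters-signs : ∀ n w → map ∣_∣ w ↭ oneTo n → w ↭ letters (signs n w)
↭-letters-signs n w ∣w∣↭ =
  ∼bag⇒↭ (unique∧set⇒bag (UniqueP.map⁻ ∣w∣-unique) (letters-unique s) (mk⇔ to from))
  where
  s : List Bool
  s = signs n w
  ∣w∣-unique : Unique (map ∣_∣ w)
  ∣w∣-unique = PermS.Unique-resp-↭ (≡-setoid ℕ) (Perm.↭⇒↭ₛ′ ≡-isEquivalence (↭-sym ∣w∣↭)) (oneTo-unique n)

  index : ∀ {x} → x ∈ w → ∃ λ i → ∣ x ∣ ≡ suc i × i ∈ range 0 n
  index x∈ with ∈-oneTo⁻ n (PermP.∈-resp-↭ ∣w∣↭ (∈-map⁺ ∣_∣ x∈))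
  ... | i , eq , i<n = i , eq , ∈-range⁺ 0 n z≤n i<n

  to : ∀ {x} → x ∈ w → x ∈ letters s
  to { -[1+ i ]} x∈ with index x∈
  ... | _ , refl , i∈R = bar∈letters s (∈-positions-of⁺ (λ j → bar j ∈ℤ? w) 0 n i∈R x∈)
  to {+ suc i} x∈ with index x∈
  ... | _ , refl , i∈R = plain∈letters s (subst (i ∈_) (cong (positions 0) (sym (unbarred-signs n w)))
        (∈-positions-of⁺ (λ j → ¬? (bar j ∈ℤ? w)) 0 n i∈R bar∉w))
    where
    bar∉w : bar i ∉ w
    bar∉w bar∈ with collision ∣_∣ w ∣w∣-unique bar∈ x∈ refl
    ... | ()
  to {+ zero} x∈ with index x∈
  ... | _ , () , _

  from : ∀ {x} → x ∈ letters s → x ∈ w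
  from x∈ with ∈-letters⁻ s x∈
  ... | inj₁ (i , refl , i∈) = proj₂ (∈-positions-of⁻ (λ j → bar j ∈ℤ? w) 0 n i∈)
  ... | inj₂ (i , refl , i∈) with ∈-positions-of⁻ (λ j → ¬? (bar j ∈ℤ? w)) 0 n
                                    (subst (i ∈_) (cong (positions 0) (unbarred-signs n w)) i∈)
  ...   | i∈R , bar∉w with ∈-map⁻ ∣_∣ (PermP.∈-resp-↭ (↭-sym ∣w∣↭) (∈-oneTo⁺ n (proj₂ (∈-range⁻ 0 n i∈R))))
  ...     | -[1+ _ ] , y∈ , refl = ⊥-elim (bar∉w y∈)
  ...     | + _      , y∈ , refl = y∈

map-injective-on : ∀ {A B : Set} (f : A → B) {W : List A} →
                   (∀ {x y} → x ∈ W → y ∈ W → f x ≡ f y → x ≡ y) →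
                   ∀ {a b} → All (_∈ W) a → All (_∈ W) b → map f a ≡ map f b → a ≡ b
map-injective-on f inj []         []         _  = refl
map-injective-on f inj (x∈ ∷ a∈) (y∈ ∷ b∈) eq =
  cong₂ _∷_ (inj x∈ y∈ (ListP.∷-injectiveˡ eq)) (map-injective-on f inj a∈ b∈ (ListP.∷-injectiveʳ eq))

unique-map-injective-on : ∀ {A B : Set} (f : A → B) {xs : List A} → Unique xs →
                          (∀ {x y} → x ∈ xs → y ∈ xs → f x ≡ f y → x ≡ y) → Unique (map f xs)
unique-map-injective-on f {[]}     []                _   = []
unique-map-injective-on f {x ∷ xs} (x∉xs ∷ xs-unique) inj =
  All.tabulate fx∉ ∷ unique-map-injective-on f xs-unique (λ p q → inj (there p) (there q))
  where
  fx∉ : ∀ {z} → z ∈ map f xs → f x ≢ z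
  fx∉ z∈ eq with ∈-map⁻ f z∈
  ... | y , y∈ , refl = All.lookup x∉xs y∈ (inj (here refl) (there y∈) eq)

Bu⊆φ : ∀ n u w → u ↭ oneTo n → w ∈ Bu n u → w ≡ φ u (signs n w)
Bu⊆φ n u w u↭ w∈Bu = map-injective-on (stLetter w) (stLetter-injective w)
    (All.tabulate id) (All.tabulate (PermP.∈-resp-↭ (↭-sym w↭φ)))
    (begin
      st w                              ≡⟨ st-w≡u ⟩
      u                                 ≡⟨ st-φ u↭ s (length-signs n w) ⟨
      st (φ u s)                        ≡⟨ ListP.map-cong (λ x → cong suc (rank-↭ x (↭-sym w↭φ))) (φ u s) ⟩
      map (stLetter w) (φ u s)          ∎)
  where
  open ≡-Reasoning
  s : List Bool
  s = signs n w
  w∈Bn : w ∈ Bn n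
  w∈Bn = proj₁ (∈-filter⁻ (λ v → T? (eqListℕ (st v) u)) {xs = Bn n} w∈Bu)
  st-w≡u : st w ≡ u
  st-w≡u = eqListℕ-sound (st w) u (proj₂ (∈-filter⁻ (λ v → T? (eqListℕ (st v) u)) {xs = Bn n} w∈Bu))
  ∣w∣↭ : map ∣_∣ w ↭ oneTo n
  ∣w∣↭ = IsPerm⇒↭ n (map ∣_∣ w) (proj₂ (∈-filter⁻ (λ v → T? (inB n v)) {xs = wordsOf n (alphabet n)} w∈Bn))
  w↭φ : w ↭ φ u s
  w↭φ = ↭-trans (↭-letters-signs n w ∣w∣↭) (↭-sym (φ-↭ u↭ s (length-signs n w)))

alphabet-unique : ∀ n → Unique (alphabet n)
alphabet-unique n =
  UniqueP.++⁺ (UniqueP.map⁺ (λ { refl → refl }) (UniqueP.upTo⁺ n))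
              (UniqueP.map⁺ (λ { refl → refl }) (UniqueP.upTo⁺ n))
              (λ { (p , q) → bar≢plain p q })
  where
  bar≢plain : ∀ {x} → x ∈ map bar (upTo n) → x ∉ map plain (upTo n)
  bar≢plain p q with ∈-map⁻ bar p | ∈-map⁻ plain q
  ... | _ , _ , refl | _ , _ , ()

wordsOf-unique : ∀ k A → Unique A → Unique (wordsOf k A)
wordsOf-unique zero    A _        = [] ∷ []
wordsOf-unique (suc k) A A-unique = prepend-each A A-unique
  where
  W : List (List ℤ)
  W = wordsOf k A
  extend : ℤ → List (List ℤ)
  extend a = map (a ∷_) W
  prepend-each : ∀ B → Unique B → Unique (List.concatMap extend B)
  prepend-each []      _                 = []
  prepend-each (a ∷ B) (a∉B ∷ B-unique) =
    UniqueP.++⁺ (UniqueP.map⁺ ListP.∷-injectiveʳ (wordsOf-unique k A A-unique)) (prepend-each B B-unique)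
                (λ { (p , q) → disjoint a∉B p q })
    where
    disjoint : ∀ {B v} → All (a ≢_) B → v ∈ extend a → v ∉ List.concatMap extend B
    disjoint {b ∷ B} (a≢b ∷ a≢B) p q with ∈-++⁻ (extend b) q
    ... | inj₂ q′ = disjoint a≢B p q′
    ... | inj₁ q′ with ∈-map⁻ (a ∷_) p | ∈-map⁻ (b ∷_) q′
    ...   | _ , _ , refl | _ , _ , eq = a≢b (ListP.∷-injectiveˡ eq)

Bu-unique : ∀ n u → Unique (Bu n u)
Bu-unique n u = UniqueP.filter⁺ (λ w → T? (eqListℕ (st w) u))
  (UniqueP.filter⁺ (λ w → T? (inB n w)) (wordsOf-unique n (alphabet n) (alphabet-unique n)))

Bu↭φ : ∀ n u → u ↭ oneTo n → Bu n u ↭ map (φ u) (signVectors n)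
Bu↭φ n u u↭ = ∼bag⇒↭ (unique∧set⇒bag (Bu-unique n u)
  (unique-map-injective-on (φ u) (signVectors-unique n) φ-injective) (mk⇔ into onto))
  where
  signs-φ : ∀ {s} → s ∈ signVectors n → signs n (φ u s) ≡ s
  signs-φ {s} s∈ with ∈-signVectors⁻ n s∈
  ... | refl = trans (signs-↭ (length s) (φ-↭ u↭ s refl)) (signs-letters s)
  φ-injective : ∀ {s s′} → s ∈ signVectors n → s′ ∈ signVectors n → φ u s ≡ φ u s′ → s ≡ s′
  φ-injective s∈ s′∈ eq = trans (sym (signs-φ s∈)) (trans (cong (signs n) eq) (signs-φ s′∈))
  into : ∀ {w} → w ∈ Bu n u → w ∈ map (φ u) (signVectors n)
  into {w} w∈ = subst (_∈ map (φ u) (signVectors n)) (sym (Bu⊆φ n u w u↭ w∈))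
    (∈-map⁺ (φ u) (∈-signVectors⁺ n (signs n w) (length-signs n w)))
  onto : ∀ {w} → w ∈ map (φ u) (signVectors n) → w ∈ Bu n u
  onto w∈ with ∈-map⁻ (φ u) w∈
  ... | s , s∈ , refl = φ∈Bu u↭ s (∈-signVectors⁻ n s∈)

module GeneratingFunction {c ℓ : Level} (R : CommutativeSemiring c ℓ) (t q : CommutativeSemiring.Carrier R) where
  open CommutativeSemiring R
    using (Carrier; 1#; _≈_; setoid; isEquivalence; +-isCommutativeMonoid; +-cong; *-cong;
           +-identityˡ; +-identityʳ; *-identityˡ; distribˡ; distribʳ; *-assoc; +-assoc; *-comm; zeroʳ;
           *-commutativeSemigroup)
    renaming (_+_ to _⊕_; _*_ to _⊗_; refl to ≈-refl; sym to ≈-sym; trans to ≈-trans; reflexive to ≈-reflexive)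
  open import Relation.Binary.Reasoning.Setoid setoid
  open import Algebra.Properties.CommutativeSemigroup *-commutativeSemigroup using (interchange)

  Σ : List Carrier → Carrier
  Σ = sumR R

  Σ-↭ : ∀ {A : Set} (g : A → Carrier) {xs ys} → xs ↭ ys → Σ (map g xs) ≈ Σ (map g ys)
  Σ-↭ g xs↭ys = PermS.foldr-commMonoid setoid +-isCommutativeMonoid
                  (Perm.↭⇒↭ₛ′ isEquivalence (PermP.map⁺ g xs↭ys))

  Σ-++ : ∀ xs ys → Σ (xs ++ ys) ≈ Σ xs ⊕ Σ ys
  Σ-++ []       ys = ≈-sym (+-identityˡ (Σ ys))
  Σ-++ (x ∷ xs) ys = ≈-trans (+-cong ≈-refl (Σ-++ xs ys)) (≈-sym (+-assoc x (Σ xs) (Σ ys)))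

  Σ-*ˡ : ∀ {A : Set} a (g : A → Carrier) xs → Σ (map (λ x → a ⊗ g x) xs) ≈ a ⊗ Σ (map g xs)
  Σ-*ˡ a g []       = ≈-sym (zeroʳ a)
  Σ-*ˡ a g (x ∷ xs) = ≈-trans (+-cong ≈-refl (Σ-*ˡ a g xs)) (≈-sym (distribˡ a (g x) _))

  Σ-cong : ∀ {A : Set} {g h : A → Carrier} xs → (∀ {x} → x ∈ xs → g x ≈ h x) → Σ (map g xs) ≈ Σ (map h xs)
  Σ-cong []       _   = ≈-refl
  Σ-cong (x ∷ xs) g≈h = +-cong (g≈h (here refl)) (Σ-cong xs (g≈h ∘ there))

  pow-+ : ∀ x a b → pow R x (a + b) ≈ pow R x a ⊗ pow R x b
  pow-+ x zero    b = ≈-sym (*-identityˡ _)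
  pow-+ x (suc a) b = ≈-trans (*-cong ≈-refl (pow-+ x a b)) (≈-sym (*-assoc x _ _))

  weight : ℕ → List Bool → Carrier
  weight m s = pow R t (length (positions m s)) ⊗ pow R q (sum (map suc (positions m s)))

  factor : ℕ → Carrier
  factor i = 1# ⊕ t ⊗ pow R q i

  productFrom : ℕ → ℕ → Carrier
  productFrom m zero    = 1#
  productFrom m (suc k) = factor (suc m) ⊗ productFrom (suc m) k

  weight-true : ∀ m s → weight m (true ∷ s) ≈ (t ⊗ pow R q (suc m)) ⊗ weight (suc m) s
  weight-true m s = begin
    pow R t (suc a) ⊗ pow R q (suc m + b)             ≈⟨ *-cong ≈-refl (pow-+ q (suc m) b) ⟩
    (t ⊗ pow R t a) ⊗ (pow R q (suc m) ⊗ pow R q b)   ≈⟨ interchange t (pow R t a) (pow R q (suc m)) (pow R q b) ⟩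
    (t ⊗ pow R q (suc m)) ⊗ weight (suc m) s          ∎
    where
    a b : ℕ
    a = length (positions (suc m) s)
    b = sum (map suc (positions (suc m) s))

  -- Splitting on the first entry: the sum of weights factors as a product.
  sum-weights : ∀ m k → Σ (map (weight m) (signVectors k)) ≈ productFrom m k
  sum-weights m zero    = ≈-trans (+-identityʳ _) (*-identityˡ 1#)
  sum-weights m (suc k) = begin
    Σ (map (weight m) (map (false ∷_) S ++ map (true ∷_) S))
      ≈⟨ ≈-reflexive (cong Σ (ListP.map-++ (weight m) (map (false ∷_) S) _)) ⟩
    Σ (map (weight m) (map (false ∷_) S) ++ map (weight m) (map (true ∷_) S))
      ≈⟨ Σ-++ (map (weight m) (map (false ∷_) S)) _ ⟩
    Σ (map (weight m) (map (false ∷_) S)) ⊕ Σ (map (weight m) (map (true ∷_) S))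
      ≈⟨ +-cong (≈-reflexive (cong Σ (sym (ListP.map-∘ S)))) (≈-reflexive (cong Σ (sym (ListP.map-∘ S)))) ⟩
    Σ (map (weight (suc m)) S) ⊕ Σ (map (λ s → weight m (true ∷ s)) S)
      ≈⟨ +-cong ≈-refl (Σ-cong S (λ {s} _ → weight-true m s)) ⟩
    Σ (map (weight (suc m)) S) ⊕ Σ (map (λ s → (t ⊗ pow R q (suc m)) ⊗ weight (suc m) s) S)
      ≈⟨ +-cong (≈-sym (*-identityˡ _)) (Σ-*ˡ _ (weight (suc m)) S) ⟩
    1# ⊗ Σ (map (weight (suc m)) S) ⊕ (t ⊗ pow R q (suc m)) ⊗ Σ (map (weight (suc m)) S)
      ≈⟨ ≈-sym (distribʳ _ _ _) ⟩
    factor (suc m) ⊗ Σ (map (weight (suc m)) S)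
      ≈⟨ *-cong ≈-refl (sum-weights (suc m) k) ⟩
    productFrom m (suc k) ∎
    where
    S : List (List Bool)
    S = signVectors k

  productFrom-snoc : ∀ m k → productFrom m (suc k) ≈ productFrom m k ⊗ factor (suc (m + k))
  productFrom-snoc m zero    =
    ≈-trans (*-comm _ _) (*-cong ≈-refl (≈-reflexive (cong (factor ∘ suc) (sym (ℕP.+-identityʳ m)))))
  productFrom-snoc m (suc k) = begin
    factor (suc m) ⊗ productFrom (suc m) (suc k)
      ≈⟨ *-cong ≈-refl (productFrom-snoc (suc m) k) ⟩
    factor (suc m) ⊗ (productFrom (suc m) k ⊗ factor (suc (suc m + k)))
      ≈⟨ ≈-sym (*-assoc _ _ _) ⟩
    productFrom m (suc k) ⊗ factor (suc (suc m + k))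
      ≈⟨ *-cong ≈-refl (≈-reflexive (cong (factor ∘ suc) (sym (ℕP.+-suc m k)))) ⟩
    productFrom m (suc k) ⊗ factor (suc (m + suc k)) ∎

  prodFactor≈productFrom : ∀ n → prodFactor R t q n ≈ productFrom 0 n
  prodFactor≈productFrom zero    = ≈-refl
  prodFactor≈productFrom (suc n) =
    ≈-trans (*-cong (prodFactor≈productFrom n) ≈-refl) (≈-sym (productFrom-snoc 0 n))

  -- By (1) and (3), the monomial of φ u s is that of u times the weight of s.
  monomial : List ℤ → Carrier
  monomial w = pow R t (ndes w) ⊗ pow R q (nmaj w)

  monomial-φ : ∀ {n u} (u↭ : u ↭ oneTo n) s → length s ≡ n →
               monomial (φ u s) ≈ (pow R t (des ltℕ u) ⊗ pow R q (maj ltℕ u)) ⊗ weight 0 s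
  monomial-φ {n} {u} u↭ s ∣s∣≡n = begin
    pow R t (ndes (φ u s)) ⊗ pow R q (nmaj (φ u s))
      ≈⟨ ≈-reflexive (cong₂ (λ a b → pow R t a ⊗ pow R q b) ndes-φ nmaj-φ) ⟩
    pow R t (des ltℕ u + length P) ⊗ pow R q (maj ltℕ u + sum (map suc P))
      ≈⟨ *-cong (pow-+ t (des ltℕ u) _) (pow-+ q (maj ltℕ u) _) ⟩
    (pow R t (des ltℕ u) ⊗ pow R t (length P)) ⊗ (pow R q (maj ltℕ u) ⊗ pow R q (sum (map suc P)))
      ≈⟨ interchange _ _ _ _ ⟩
    (pow R t (des ltℕ u) ⊗ pow R q (maj ltℕ u)) ⊗ weight 0 s ∎
    where
    P : List ℕ
    P = positions 0 s
    ndes-φ : ndes (φ u s) ≡ des ltℕ u + length P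
    ndes-φ = cong₂ _+_ (cong length (Des-φ u↭ s ∣s∣≡n)) (negCount-φ u↭ s ∣s∣≡n)
    nmaj-φ : nmaj (φ u s) ≡ maj ltℕ u + sum (map suc P)
    nmaj-φ = cong₂ _+_ (cong sum (Des-φ u↭ s ∣s∣≡n)) (negSum-φ u↭ s ∣s∣≡n)

theorem4 : ∀ {c ℓ : Level} (R : CommutativeSemiring c ℓ) (t q : CommutativeSemiring.Carrier R)
           (n : ℕ) (u : List ℕ) → IsPerm n u →
           CommutativeSemiring._≈_ R
             (CommutativeSemiring._*_ R
               (CommutativeSemiring._*_ R (pow R t (des ltℕ u)) (pow R q (maj ltℕ u)))
               (prodFactor R t q n))
             (sumR R (map (λ w → CommutativeSemiring._*_ R (pow R t (ndes w)) (pow R q (nmaj w))) (Bu n u)))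
theorem4 R t q n u isPerm = begin
  A ⊗ prodFactor R t q n                                ≈⟨ *-cong ≈-refl (prodFactor≈productFrom n) ⟩
  A ⊗ productFrom 0 n                                   ≈⟨ *-cong ≈-refl (sum-weights 0 n) ⟨
  A ⊗ Σ (map (weight 0) (signVectors n))                ≈⟨ Σ-*ˡ A (weight 0) (signVectors n) ⟨
  Σ (map (λ s → A ⊗ weight 0 s) (signVectors n))        ≈⟨ Σ-cong (signVectors n) monomial-of-φ ⟨
  Σ (map (monomial ∘ φ u) (signVectors n))              ≡⟨ cong Σ (ListP.map-∘ (signVectors n)) ⟩
  Σ (map monomial (map (φ u) (signVectors n)))          ≈⟨ Σ-↭ monomial (Bu↭φ n u u↭) ⟨
  Σ (map monomial (Bu n u))                             ∎
  where
  open CommutativeSemiring R using (_≈_; setoid; *-cong) renaming (_*_ to _⊗_; refl to ≈-refl)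
  open import Relation.Binary.Reasoning.Setoid setoid
  open GeneratingFunction R t q
  u↭ : u ↭ oneTo n
  u↭ = IsPerm⇒↭ n u isPerm
  A : CommutativeSemiring.Carrier R
  A = pow R t (des ltℕ u) ⊗ pow R q (maj ltℕ u)
  monomial-of-φ : ∀ {s} → s ∈ signVectors n → monomial (φ u s) ≈ A ⊗ weight 0 s
  monomial-of-φ {s} s∈ = monomial-φ u↭ s (∈-signVectors⁻ n s∈)
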